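{- Let $G$ be a block-cycle graph and let $B$ be a pendant block of $G$, sharing the vertex $u$ with the other blocks. Let $G\setminus B$ denote the graph obtained from $G$ by deleting all vertices of $B$ other than $u$. Then $P(G\setminus B)\le P(G)$.
   Context: All graphs are finite and simple. A block is a maximal connected induced subgraph without cut-vertices. A block-cycle graph is a graph each of whose blocks is an edge or a cycle; a block is pendant if exactly one of its vertices is shared with other blocks. $P(G)$ is the minimum number of vertex-disjoint induced paths covering $V(G)$. -}

module Defs where

open import Level using (0ℓ)
open import Data.Nat using (ℕ; zero; suc; _≤_)
open import Data.Fin using (Fin; toℕ)
open import Data.List using (List; []; length; lookup; concat)
open import Data.List.Relation.Unary.All using (All)
open import Data.List.Relation.Unary.Unique.Propositional using (Unique)
open import Data.List.Membership.Propositional using (_∈_)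
open import Data.Product using (Σ; ∃; ∃-syntax; _×_; _,_)
open import Data.Sum using (_⊎_)
open import Relation.Nullary using (¬_)
open import Relation.Binary.PropositionalEquality using (_≡_; _≢_)
open import Function.Bundles using (_⇔_)
open import Data.Unit using (⊤)

record Graph (n : ℕ) : Set₁ where
  field
    Adj   : Fin n → Fin n → Set
    sym   : ∀ {x y} → Adj x y → Adj y x
    irrefl : ∀ {x} → ¬ Adj x x
open Graph public

-- Vertex sets (of induced subgraphs) are predicates on the vertices.
VSet : ℕ → Set₁
VSet n = Fin n → Set

module _ {n : ℕ} (G : Graph n) where

  data Reach (X : VSet n) : Fin n → Fin n → Set where
    here : ∀ {a} → X a → Reach X a a
    step : ∀ {a b c} → X a → Adj G a b → Reach X b c → Reach X a c

  Connected : VSet n → Set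
  Connected X = (∃[ v ] X v) × (∀ a b → X a → X b → Reach X a b)

  _－_ : VSet n → Fin n → VSet n
  (X － v) w = X w × w ≢ v

  IsCutVertex : VSet n → Fin n → Set
  IsCutVertex X v = X v × ∃[ a ] ∃[ b ] ((X － v) a × (X － v) b × ¬ Reach (X － v) a b)

  Nonseparable : VSet n → Set
  Nonseparable X = Connected X × (∀ v → ¬ IsCutVertex X v)

  _⊆_ : VSet n → VSet n → Set
  X ⊆ Y = ∀ v → X v → Y v

  SameSet : VSet n → VSet n → Set
  SameSet X Y = ∀ v → X v ⇔ Y v

  IsBlock : VSet n → Set₁
  IsBlock X = Nonseparable X × (∀ Y → X ⊆ Y → Nonseparable Y → Y ⊆ X)

  IsEdgeBlock : VSet n → Set
  IsEdgeBlock X = ∃[ a ] ∃[ b ] (a ≢ b × Adj G a b × (∀ v → X v ⇔ (v ≡ a ⊎ v ≡ b)))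

  CycAdjIdx : ℕ → ℕ → ℕ → Set
  CycAdjIdx k i j = j ≡ suc i ⊎ i ≡ suc j ⊎ (i ≡ 0 × suc j ≡ k) ⊎ (j ≡ 0 × suc i ≡ k)

  IsCycleBlock : VSet n → Set
  IsCycleBlock X = Σ (List (Fin n)) λ xs →
      3 ≤ length xs × Unique xs × (∀ v → X v ⇔ v ∈ xs)
    × (∀ i j → Adj G (lookup xs i) (lookup xs j) ⇔ CycAdjIdx (length xs) (toℕ i) (toℕ j))

  IsBlockCycleGraph : Set₁
  IsBlockCycleGraph = ∀ X → IsBlock X → IsEdgeBlock X ⊎ IsCycleBlock X

  InOtherBlock : VSet n → Fin n → Set₁
  InOtherBlock B v = ∃[ C ] (IsBlock C × ¬ SameSet C B × C v)

  IsPendantBlockAt : VSet n → Fin n → Set₁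
  IsPendantBlockAt B u = IsBlock B × B u × InOtherBlock B u
                       × (∀ w → B w → InOtherBlock B w → w ≡ u)

  DeleteBlock : VSet n → Fin n → VSet n
  DeleteBlock B u v = ¬ B v ⊎ v ≡ u

  -- xs is an induced path of G (listed in path order; one vertex allowed)
  IsInducedPath : List (Fin n) → Set
  IsInducedPath xs = xs ≢ [] × Unique xs
    × (∀ i j → Adj G (lookup xs i) (lookup xs j) ⇔ (toℕ j ≡ suc (toℕ i) ⊎ toℕ i ≡ suc (toℕ j)))

  HasPathCover : VSet n → ℕ → Set
  HasPathCover W k = Σ (List (List (Fin n))) λ ps →
      length ps ≡ k × All IsInducedPath ps × Unique (concat ps)
    × (∀ v → W v ⇔ v ∈ concat ps)

  IsPathCoverNumber : VSet n → ℕ → Set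
  IsPathCoverNumber W m = HasPathCover W m × (∀ k → HasPathCover W k → m ≤ k)

  AllV : VSet n
  AllV _ = ⊤

module Submission where

-- Let B be a pendant block of G attached at u, and let D = (V ∖ B) ∪ {u}
-- be the vertex set of G ∖ B.  The whole argument rests on one graph
-- fact: every edge ab with a ∉ D and b ∈ D ends in b = u.  Indeed a ∈ B,
-- a ≠ u, and the edge {a,b} is nonseparable, hence lies in some block C;
-- if b ∉ B then C ≠ B, so a lies in two blocks and must be u.  The block
-- C exists by a finite maximality argument (maximal-above).  Membership
-- in vertex sets is not decidable, so that argument is classical and
-- yields C only under double negation; this suffices, as the fact is
-- proved by contradiction anyway.
--
-- Consequently, along any induced path P of G the vertices of D form one
-- contiguous segment: P splits as (outside D) ++ (inside D) ++ (outside D),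
-- the crossing points being u, which P visits at most once.  A contiguous
-- segment of an induced path is an induced path, so intersecting each
-- path of an optimal cover of G with D and dropping empty pieces yields a
-- cover of G ∖ B by at most P(G) induced paths.

open import Defs
open import Data.Nat using (ℕ; zero; suc; _≤_; s≤s)
open import Data.Nat.Properties using (≤-refl; ≤-trans; ≤-reflexive; m≤n⇒m≤1+n; suc-injective)
open import Data.Fin using (Fin; zero; suc; toℕ; _≟_)
open import Data.Fin.Subset using (Subset; inside; outside; _⊃_) renaming (_∈_ to _∈ₛ_)
open import Data.Fin.Subset.Properties using (_∈?_; drop-there)
open import Data.Fin.Subset.Induction using (⊃-wellFounded)
open import Data.Vec.Base using ([]; _∷_; here; there)
open import Data.List using (List; []; _∷_; _++_; [_]; length; lookup; concat; map; filter)
open import Data.List.Properties using (++-identityʳ; ++-assoc; ++-conicalˡ; ++-conicalʳ; length-map; filter-++; filter-all; filter-none)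
open import Data.List.Relation.Unary.All as All using (All; []; _∷_)
open import Data.List.Relation.Unary.All.Properties using (++⁻ˡ; ++⁻ʳ) renaming (++⁺ to All-++⁺; map⁺ to All-map⁺)
open import Data.List.Relation.Unary.Any using (here; there)
open import Data.List.Relation.Unary.AllPairs using ([]; _∷_)
open import Data.List.Relation.Unary.Linked using (Linked; []; [-]; _∷_)
open import Data.List.Relation.Unary.Unique.Propositional using (Unique)
open import Data.List.Relation.Unary.Unique.Propositional.Properties using (Unique[x∷xs]⇒x∉xs) renaming (filter⁺ to Unique-filter⁺)
open import Data.List.Membership.Propositional using (_∈_; _∉_)
open import Data.List.Membership.Propositional.Properties using (∈-∃++; ∈-filter⁺; ∈-filter⁻)
import Data.List.Membership.DecPropositional as DecMembership
open import Data.Product using (Σ; ∃-syntax; _×_; _,_; proj₂)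
open import Data.Sum using (_⊎_; inj₁; inj₂)
import Data.Sum as Sum
open import Data.Empty using (⊥-elim)
open import Data.Unit using (tt)
open import Function using (_∘_)
open import Function.Bundles using (_⇔_; mk⇔; Equivalence)
open import Induction.WellFounded using (Acc; acc)
open import Relation.Nullary using (¬_; Dec; yes; no)
open import Relation.Nullary.Decidable using (¬¬-excluded-middle)
open import Relation.Unary using (_⊆′_; Decidable)
open import Relation.Binary.PropositionalEquality using (_≡_; _≢_; refl; trans; cong; cong₂; subst; subst₂; module ≡-Reasoning) renaming (sym to ≡-sym)

open Equivalence using (to; from)

⟦_⟧ : ∀ {n} → Subset n → VSet n
⟦ s ⟧ v = v ∈ₛ s

¬¬-asSubset : ∀ {n} (X : VSet n) → ¬ ¬ (Σ (Subset n) λ s → ∀ v → X v ⇔ v ∈ₛ s)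
¬¬-asSubset {zero} X k = k ([] , λ ())
¬¬-asSubset {suc n} X k = ¬¬-asSubset (X ∘ suc) λ (s , X≃s) → ¬¬-excluded-middle λ
  { (yes X0) → k (inside ∷ s , λ
      { zero → mk⇔ (λ _ → here) (λ _ → X0)
      ; (suc v) → mk⇔ (there ∘ to (X≃s v)) (from (X≃s v) ∘ drop-there) })
  ; (no ¬X0) → k (outside ∷ s , λ
      { zero → mk⇔ (⊥-elim ∘ ¬X0) (λ ())
      ; (suc v) → mk⇔ (there ∘ to (X≃s v)) (from (X≃s v) ∘ drop-there) }) }

-- For any property Q of vertex sets that is invariant under having the
-- same elements, every Q-set lies (classically) in a maximal Q-set:
-- a strictly increasing chain of subsets of a finite set is finite.
module Maximality {n : ℕ} (Q : VSet n → Set)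
    (Q-resp : ∀ {X Y} → (∀ v → X v ⇔ Y v) → Q X → Q Y) where

  IsMaximal : VSet n → Set₁
  IsMaximal C = Q C × (∀ Y → C ⊆′ Y → Q Y → Y ⊆′ C)

  MaximalAbove : VSet n → Set₁
  MaximalAbove X = ∃[ C ] (IsMaximal C × X ⊆′ C)

  -- Induction on strict supersets: either ⟦ s ⟧ is itself maximal, or a
  -- Q-set strictly above it yields a maximal set above it.
  maximal-above-subset : ∀ s → Acc _⊃_ s → Q ⟦ s ⟧ → ¬ ¬ MaximalAbove ⟦ s ⟧
  maximal-above-subset s (acc larger) Qs noMaximal = noMaximal (⟦ s ⟧ , (Qs , maximal) , λ _ v∈s → v∈s)
    where
    maximal : ∀ Y → ⟦ s ⟧ ⊆′ Y → Q Y → Y ⊆′ ⟦ s ⟧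
    maximal Y s⊆Y QY v Yv with v ∈? s
    ... | yes v∈s = v∈s
    ... | no v∉s = ⊥-elim (¬¬-asSubset Y λ (t , Y≃t) →
          maximal-above-subset t
            (larger ((λ {w} w∈s → to (Y≃t w) (s⊆Y w w∈s)) , v , to (Y≃t v) Yv , v∉s))
            (Q-resp Y≃t QY)
            (λ (C , maxC , t⊆C) → noMaximal (C , maxC , λ w w∈s → t⊆C w (to (Y≃t w) (s⊆Y w w∈s)))))

  maximal-above : ∀ X → Q X → ¬ ¬ MaximalAbove X
  maximal-above X QX noMaximal = ¬¬-asSubset X λ (s , X≃s) →
    maximal-above-subset s (⊃-wellFounded s) (Q-resp X≃s QX)
      (λ (C , maxC , s⊆C) → noMaximal (C , maxC , λ v Xv → s⊆C v (to (X≃s v) Xv)))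

module BlockFacts {n : ℕ} (G : Graph n) where

  reach-mono : ∀ {X Y} → X ⊆′ Y → ∀ {a b} → Reach G X a b → Reach G Y a b
  reach-mono X⊆Y (here Xa) = here (X⊆Y _ Xa)
  reach-mono X⊆Y (step Xa a~b r) = step (X⊆Y _ Xa) a~b (reach-mono X⊆Y r)

  nonseparable-resp : ∀ {X Y} → SameSet G X Y → Nonseparable G X → Nonseparable G Y
  nonseparable-resp {X} {Y} X≃Y (((w , Xw) , conn) , noCut) =
    ((w , to (X≃Y w) Xw) , λ a b Ya Yb → reach-mono (to ∘ X≃Y) (conn a b (from (X≃Y a) Ya) (from (X≃Y b) Yb))) ,
    λ { v (Yv , a , b , (Ya , a≢v) , (Yb , b≢v) , ¬reach) →
      noCut v (from (X≃Y v) Yv , a , b , (from (X≃Y a) Ya , a≢v) , (from (X≃Y b) Yb , b≢v) ,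
        ¬reach ∘ reach-mono (λ x (Xx , x≢v) → to (X≃Y x) Xx , x≢v)) }

  block-above : ∀ X → Nonseparable G X → ¬ ¬ (∃[ C ] (IsBlock G C × X ⊆′ C))
  block-above = Maximality.maximal-above (Nonseparable G) (nonseparable-resp)

  Pair : Fin n → Fin n → VSet n
  Pair a b v = v ≡ a ⊎ v ≡ b

  -- An edge is nonseparable: deleting one endpoint leaves a single vertex.
  edge-nonseparable : ∀ {a b} → Adj G a b → Nonseparable G (Pair a b)
  edge-nonseparable {a} {b} a~b = ((a , inj₁ refl) , connected) , λ v (Pv , x , y , (Px , x≢v) , (Py , y≢v) , ¬reach) →
      ¬reach (only-one-left Pv Px Py x≢v y≢v)
    where
    connected : ∀ x y → Pair a b x → Pair a b y → Reach G (Pair a b) x y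
    connected x y (inj₁ refl) (inj₁ refl) = here (inj₁ refl)
    connected x y (inj₁ refl) (inj₂ refl) = step (inj₁ refl) a~b (here (inj₂ refl))
    connected x y (inj₂ refl) (inj₁ refl) = step (inj₂ refl) (sym G a~b) (here (inj₁ refl))
    connected x y (inj₂ refl) (inj₂ refl) = here (inj₂ refl)
    only-one-left : ∀ {v x y} → Pair a b v → Pair a b x → Pair a b y → x ≢ v → y ≢ v
                  → Reach G (_－_ G (Pair a b) v) x y
    only-one-left (inj₁ refl) (inj₁ refl) _ x≢v _ = ⊥-elim (x≢v refl)
    only-one-left (inj₁ refl) _ (inj₁ refl) _ y≢v = ⊥-elim (y≢v refl)
    only-one-left (inj₁ refl) (inj₂ refl) (inj₂ refl) x≢v _ = here (inj₂ refl , x≢v)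
    only-one-left (inj₂ refl) (inj₂ refl) _ x≢v _ = ⊥-elim (x≢v refl)
    only-one-left (inj₂ refl) _ (inj₂ refl) _ y≢v = ⊥-elim (y≢v refl)
    only-one-left (inj₂ refl) (inj₁ refl) (inj₁ refl) x≢v _ = here (inj₁ refl , x≢v)

  -- A neighbour of a non-attachment vertex of a pendant block B lies in B:
  -- otherwise the block containing the edge would be a second block at a.
  pendant-closed : ∀ {B u a b} → IsPendantBlockAt G B u → B a → a ≢ u → Adj G a b → ¬ ¬ B b
  pendant-closed (_ , _ , _ , onlyAttachment) Ba a≢u a~b ¬Bb =
    block-above _ (edge-nonseparable a~b) λ (C , C-block , ab⊆C) →
      a≢u (onlyAttachment _ Ba (C , C-block , (λ C≃B → ¬Bb (to (C≃B _) (ab⊆C _ (inj₂ refl)))) , ab⊆C _ (inj₁ refl)))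

  deleted-separated : ∀ {B u a b} → IsPendantBlockAt G B u
    → ¬ DeleteBlock G B u a → DeleteBlock G B u b → Adj G a b → b ≡ u
  deleted-separated pendant ¬Da (inj₂ b≡u) _ = b≡u
  deleted-separated pendant ¬Da (inj₁ ¬Bb) a~b =
    ⊥-elim (¬Da (inj₁ λ Ba → pendant-closed pendant Ba (¬Da ∘ inj₂) a~b ¬Bb))

_∈ᴸ?_ : ∀ {n} (v : Fin n) (xs : List (Fin n)) → Dec (v ∈ xs)
_∈ᴸ?_ {n} = DecMembership._∈?_ (_≟_ {n})

module _ {A : Set} where

  linked-++⁻ : ∀ {R : A → A → Set} xs {ys} → Linked R (xs ++ ys) → Linked R xs × Linked R ys
  linked-++⁻ [] l = [] , l
  linked-++⁻ (x ∷ []) [-] = [-] , []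
  linked-++⁻ (x ∷ []) (_ ∷ l) = [-] , l
  linked-++⁻ (x ∷ y ∷ xs) (r ∷ l) with linked-++⁻ (y ∷ xs) l
  ... | lxs , lys = r ∷ lxs , lys

  linked-tail : ∀ {R : A → A → Set} {x xs} → Linked R (x ∷ xs) → Linked R xs
  linked-tail [-] = []
  linked-tail (_ ∷ l) = l

  unique-prefix : ∀ xs {ws : List A} → Unique (xs ++ ws) → Unique xs
  unique-prefix [] _ = []
  unique-prefix (x ∷ xs) (x∉ ∷ uq) = ++⁻ˡ xs x∉ ∷ unique-prefix xs uq

  unique-splitAt : ∀ ys {x : A} {zs} → Unique (ys ++ x ∷ zs) → x ∉ ys × x ∉ zs
  unique-splitAt [] uq = (λ ()) , Unique[x∷xs]⇒x∉xs uq
  unique-splitAt (y ∷ ys) (y∉ ∷ uq) with unique-splitAt ys uq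
  ... | x∉ys , x∉zs = x∉y∷ys , x∉zs
    where
    x∉y∷ys : _ ∉ y ∷ ys
    x∉y∷ys (here refl) with ++⁻ʳ ys y∉
    ... | y≢y ∷ _ = y≢y refl
    x∉y∷ys (there x∈ys) = x∉ys x∈ys

  concat-map-filter : ∀ {P : A → Set} (P? : Decidable P) xss
    → concat (map (filter P?) xss) ≡ filter P? (concat xss)
  concat-map-filter P? [] = refl
  concat-map-filter P? (xs ∷ xss) =
    trans (cong (filter P? xs ++_) (concat-map-filter P? xss)) (≡-sym (filter-++ P? xs (concat xss)))

  dropEmpty : List (List A) → List (List A)
  dropEmpty [] = []
  dropEmpty ([] ∷ xss) = dropEmpty xss
  dropEmpty ((x ∷ xs) ∷ xss) = (x ∷ xs) ∷ dropEmpty xss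

  concat-dropEmpty : ∀ xss → concat (dropEmpty xss) ≡ concat xss
  concat-dropEmpty [] = refl
  concat-dropEmpty ([] ∷ xss) = concat-dropEmpty xss
  concat-dropEmpty ((x ∷ xs) ∷ xss) = cong ((x ∷ xs) ++_) (concat-dropEmpty xss)

  length-dropEmpty : ∀ xss → length (dropEmpty xss) ≤ length xss
  length-dropEmpty [] = ≤-refl
  length-dropEmpty ([] ∷ xss) = m≤n⇒m≤1+n (length-dropEmpty xss)
  length-dropEmpty ((x ∷ xs) ∷ xss) = s≤s (length-dropEmpty xss)

  all-dropEmpty : ∀ {Q : List A → Set} {xss} → All (λ xs → xs ≢ [] → Q xs) xss → All Q (dropEmpty xss)
  all-dropEmpty [] = []
  all-dropEmpty {xss = [] ∷ _} (_ ∷ qs) = all-dropEmpty qs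
  all-dropEmpty {xss = (_ ∷ _) ∷ _} (q ∷ qs) = q (λ ()) ∷ all-dropEmpty qs

module InducedPaths {n : ℕ} (G : Graph n) where

  IP : List (Fin n) → Set
  IP = IsInducedPath G

  Consecutive : ℕ → ℕ → Set
  Consecutive i j = j ≡ suc i ⊎ i ≡ suc j

  consecutive-suc : ∀ {i j} → Consecutive (suc i) (suc j) ⇔ Consecutive i j
  consecutive-suc = mk⇔ (Sum.map suc-injective suc-injective) (Sum.map (cong suc) (cong suc))

  induced-tail : ∀ {x xs} → IP (x ∷ xs) → xs ≢ [] → IP xs
  induced-tail (_ , (_ ∷ uq) , adj) ne = ne , uq , λ i j →
    mk⇔ (to consecutive-suc ∘ to (adj (suc i) (suc j))) (from (adj (suc i) (suc j)) ∘ from consecutive-suc)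

  induced-suffix : ∀ ys {zs} → IP (ys ++ zs) → zs ≢ [] → IP zs
  induced-suffix [] ip ne = ip
  induced-suffix (y ∷ ys) {zs} ip ne = induced-suffix ys (induced-tail ip (ne ∘ ++-conicalʳ ys zs)) ne

  prefixIndex : ∀ xs {ws : List (Fin n)} → Fin (length xs) → Fin (length (xs ++ ws))
  prefixIndex (x ∷ xs) zero = zero
  prefixIndex (x ∷ xs) (suc i) = suc (prefixIndex xs i)

  lookup-prefixIndex : ∀ xs {ws} i → lookup (xs ++ ws) (prefixIndex xs i) ≡ lookup xs i
  lookup-prefixIndex (x ∷ xs) zero = refl
  lookup-prefixIndex (x ∷ xs) (suc i) = lookup-prefixIndex xs i

  toℕ-prefixIndex : ∀ xs {ws} i → toℕ (prefixIndex xs {ws} i) ≡ toℕ i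
  toℕ-prefixIndex (x ∷ xs) zero = refl
  toℕ-prefixIndex (x ∷ xs) (suc i) = cong suc (toℕ-prefixIndex xs i)

  induced-prefix : ∀ xs {ws} → IP (xs ++ ws) → xs ≢ [] → IP xs
  induced-prefix xs {ws} (_ , uq , adj) ne = ne , unique-prefix xs uq , λ i j →
    let ι = prefixIndex xs {ws}
        adj′ = adj (ι i) (ι j)
        lk = lookup-prefixIndex xs {ws}
        tn = toℕ-prefixIndex xs {ws}
    in mk⇔ (subst₂ Consecutive (tn i) (tn j) ∘ to adj′ ∘ subst₂ (Adj G) (≡-sym (lk i)) (≡-sym (lk j)))
           (subst₂ (Adj G) (lk i) (lk j) ∘ from adj′ ∘ subst₂ Consecutive (≡-sym (tn i)) (≡-sym (tn j)))

  induced-infix : ∀ ys {zs ws} → IP (ys ++ zs ++ ws) → zs ≢ [] → IP zs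
  induced-infix ys {zs} {ws} ip ne = induced-prefix zs (induced-suffix ys ip (ne ∘ ++-conicalˡ zs ws)) ne

  induced-linked : ∀ {xs} → IP xs → Linked (Adj G) xs
  induced-linked {[]} _ = []
  induced-linked {x ∷ []} _ = [-]
  induced-linked {x ∷ y ∷ xs} ip@(_ , _ , adj) = from (adj zero (suc zero)) (inj₁ refl) ∷ induced-linked (induced-tail ip λ ())

  cover-resp : ∀ {W W′ k} → SameSet G W W′ → HasPathCover G W k → HasPathCover G W′ k
  cover-resp W≃W′ (ps , len , induced , unique , covers) =
    ps , len , induced , unique , λ v → mk⇔ (to (covers v) ∘ from (W≃W′ v)) (to (W≃W′ v) ∘ from (covers v))

module Restriction {n : ℕ} (G : Graph n) (Good : VSet n) (good? : Decidable Good)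
    (u : Fin n) (good-u : Good u)
    (separated : ∀ {a b} → ¬ Good a → Good b → Adj G a b → b ≡ u) where

  open InducedPaths G

  Bad : VSet n
  Bad v = ¬ Good v

  homogeneous : ∀ {xs} → Linked (Adj G) xs → u ∉ xs → All Good xs ⊎ All Bad xs
  homogeneous [] _ = inj₁ []
  homogeneous {x ∷ []} [-] _ with good? x
  ... | yes g = inj₁ (g ∷ [])
  ... | no b = inj₂ (b ∷ [])
  homogeneous {x ∷ y ∷ _} (x~y ∷ l) u∉ with homogeneous l (u∉ ∘ there) | good? x
  ... | inj₁ gs | yes gx = inj₁ (gx ∷ gs)
  ... | inj₁ (gy ∷ _) | no bx = ⊥-elim (u∉ (there (here (≡-sym (separated bx gy x~y)))))
  ... | inj₂ (by ∷ _) | yes gx = ⊥-elim (u∉ (here (≡-sym (separated by gx (sym G x~y)))))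
  ... | inj₂ bs | no bx = inj₂ (bx ∷ bs)

  Segments : List (Fin n) → Set
  Segments P = ∃[ ys ] ∃[ zs ] ∃[ ws ] (P ≡ ys ++ zs ++ ws × All Bad ys × All Good zs × All Bad ws)

  -- A duplicate-free walk has this shape: it visits u at most once, and
  -- the parts before and after u are homogeneous.
  three-segments : ∀ {P} → Linked (Adj G) P → Unique P → Segments P
  three-segments {P} l uq with u ∈ᴸ? P
  ... | no u∉P with homogeneous l u∉P
  ...   | inj₁ good = [] , P , [] , ≡-sym (++-identityʳ P) , [] , good , []
  ...   | inj₂ bad = P , [] , [] , ≡-sym (++-identityʳ P) , bad , [] , []
  three-segments l uq | yes u∈P with ∈-∃++ u∈P
  ... | ys , zs , refl with linked-++⁻ ys l | unique-splitAt ys uq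
  ... | lys , lzs | u∉ys , u∉zs with homogeneous lys u∉ys | homogeneous (linked-tail lzs) u∉zs
  ... | inj₁ gys | inj₁ gzs = [] , ys ++ u ∷ zs , [] , ≡-sym (++-identityʳ _) , [] , All-++⁺ gys (good-u ∷ gzs) , []
  ... | inj₂ bys | inj₁ gzs = ys , u ∷ zs , [] , cong (ys ++_) (≡-sym (++-identityʳ _)) , bys , good-u ∷ gzs , []
  ... | inj₁ gys | inj₂ bzs = [] , ys ++ [ u ] , zs , ≡-sym (++-assoc ys [ u ] zs) , [] , All-++⁺ gys (good-u ∷ []) , bzs
  ... | inj₂ bys | inj₂ bzs = ys , [ u ] , zs , refl , bys , good-u ∷ [] , bzs

  filter-segments : ∀ {ys zs ws} → All Bad ys → All Good zs → All Bad ws → filter good? (ys ++ zs ++ ws) ≡ zs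
  filter-segments {ys} {zs} {ws} bys gzs bws = begin
    filter good? (ys ++ zs ++ ws)            ≡⟨ filter-++ good? ys (zs ++ ws) ⟩
    filter good? ys ++ filter good? (zs ++ ws) ≡⟨ cong₂ _++_ (filter-none good? bys) (filter-++ good? zs ws) ⟩
    filter good? zs ++ filter good? ws        ≡⟨ cong₂ _++_ (filter-all good? gzs) (filter-none good? bws) ⟩
    zs ++ []                                 ≡⟨ ++-identityʳ zs ⟩
    zs                                       ∎
    where open ≡-Reasoning

  filter-induced : ∀ {P} → IP P → filter good? P ≢ [] → IP (filter good? P)
  filter-induced ip@(_ , uq , _) ne with three-segments (induced-linked ip) uq
  ... | ys , zs , ws , refl , bys , gzs , bws =
    subst IP (≡-sym eq) (induced-infix ys ip (ne ∘ trans eq))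
    where
    eq : filter good? (ys ++ zs ++ ws) ≡ zs
    eq = filter-segments bys gzs bws

  restrict-cover : ∀ {W k} → HasPathCover G W k → Good ⊆′ W → ∃[ k′ ] (k′ ≤ k × HasPathCover G Good k′)
  restrict-cover (ps , refl , induced , unique , covers) Good⊆W =
    length ps′ , bound , ps′ , refl , all-dropEmpty (All-map⁺ (All.map filter-induced induced)) ,
    subst Unique (≡-sym concat-ps′) (Unique-filter⁺ good? unique) ,
    λ v → mk⇔ (λ g → subst (v ∈_) (≡-sym concat-ps′) (∈-filter⁺ good? (to (covers v) (Good⊆W v g)) g))
              (λ v∈ → proj₂ (∈-filter⁻ good? {xs = concat ps} (subst (v ∈_) concat-ps′ v∈)))
    where
    ps′ : List (List (Fin n))
    ps′ = dropEmpty (map (filter good?) ps)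
    concat-ps′ : concat ps′ ≡ filter good? (concat ps)
    concat-ps′ = trans (concat-dropEmpty (map (filter good?) ps)) (concat-map-filter good? ps)
    bound : length ps′ ≤ length ps
    bound = ≤-trans (length-dropEmpty (map (filter good?) ps)) (≤-reflexive (length-map (filter good?) ps))

-- The vertex set of G ∖ B is decided through its given path cover qs;
-- restricting an optimal cover of G to it gives a cover of size ≤ p.
lemma3p2 : ∀ {n : ℕ} (G : Graph n) (B : VSet n) (u : Fin n)
    → IsBlockCycleGraph G
    → IsPendantBlockAt G B u
    → (p q : ℕ)
    → IsPathCoverNumber G (AllV G) p
    → IsPathCoverNumber G (DeleteBlock G B u) q
    → q ≤ p
lemma3p2 {n} G B u _ pendant p q (coverG , _) ((qs , _ , _ , _ , qs-covers) , q-minimal) =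
  let (k , k≤p , cover) = Restriction.restrict-cover G InRest (_∈ᴸ? concat qs) u
                            (to (qs-covers u) (inj₂ refl)) separated coverG (λ _ _ → tt)
  in ≤-trans (q-minimal k (InducedPaths.cover-resp G (λ v → mk⇔ (from (qs-covers v)) (to (qs-covers v))) cover)) k≤p
  where
  InRest : VSet n
  InRest v = v ∈ concat qs
  separated : ∀ {a b} → ¬ InRest a → InRest b → Adj G a b → b ≡ u
  separated ¬Ra Rb = BlockFacts.deleted-separated G pendant (¬Ra ∘ to (qs-covers _)) (from (qs-covers _) Rb)
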